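{- For variables $U,V,W,X,Y$, neither the set of asymmetric equations $\{U =^{\downarrow} V\times W,\ U =^{\downarrow} X+Y\}$ nor the set $\{U =^{\downarrow} V\times W,\ X+Y =^{\downarrow} U\}$ has an asymmetric $R,\emptyset$-unifier.
   Context: Signature: binary symbols $+,\times$; terms are built from these and variables. $R=\{X\times(Y+Z)\to X\times Y+X\times Z\}$, $E=\emptyset$, and $\Delta$ is the equational theory generated by $X\times(Y+Z)=X\times Y+X\times Z$. $R$ is confluent and terminating; $t\downarrow$ denotes the $R$-normal form of $t$. A substitution $\delta$ is an asymmetric $R,\emptyset$-unifier of a set $\{s_1=^{\downarrow}t_1,\dots,s_n=^{\downarrow}t_n\}$ iff for each $i$, $\delta(s_i)=_\Delta\delta(t_i)$ and $(t_i\downarrow)\delta$ is in $R$-normal form. Standing convention: all substitutions are $R$-normalized, i.e., map every variable to an $R$-normal form. -}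

module Defs where

open import Data.Nat using (ℕ)
open import Data.Product using (_×_; Σ; _,_)
open import Data.List using (List)
open import Data.List.Relation.Unary.All using (All)
open import Relation.Nullary using (¬_)

data Term : Set where
  var : ℕ → Term
  _⊕_ : Term → Term → Term
  _⊗_ : Term → Term → Term

infixl 6 _⊕_
infixl 7 _⊗_

-- One rewrite step of R = { X×(Y+Z) → X×Y + X×Z } at any position.
data _⟶_ : Term → Term → Set where
  root : ∀ x y z → (x ⊗ (y ⊕ z)) ⟶ ((x ⊗ y) ⊕ (x ⊗ z))
  ⊕ˡ   : ∀ {s s'} t → s ⟶ s' → (s ⊕ t) ⟶ (s' ⊕ t)
  ⊕ʳ   : ∀ s {t t'} → t ⟶ t' → (s ⊕ t) ⟶ (s ⊕ t')
  ⊗ˡ   : ∀ {s s'} t → s ⟶ s' → (s ⊗ t) ⟶ (s' ⊗ t)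
  ⊗ʳ   : ∀ s {t t'} → t ⟶ t' → (s ⊗ t) ⟶ (s ⊗ t')

data _⟶*_ : Term → Term → Set where
  ε   : ∀ {t} → t ⟶* t
  _◅_ : ∀ {s t u} → s ⟶ t → t ⟶* u → s ⟶* u

NF : Term → Set
NF t = ∀ t' → ¬ (t ⟶ t')

-- n is the R-normal form of t  (i.e. n = t↓; unique since R is confluent and terminating).
_↓≡_ : Term → Term → Set
t ↓≡ n = (t ⟶* n) × NF n

-- The equational theory Δ generated by X×(Y+Z) = X×Y + X×Z:
-- the equivalence closure of the (already context- and instance-closed) rewrite relation.
data _=Δ_ : Term → Term → Set where
  Δ-refl  : ∀ {t} → t =Δ t
  Δ-sym   : ∀ {s t} → s =Δ t → t =Δ s
  Δ-trans : ∀ {s t u} → s =Δ t → t =Δ u → s =Δ u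
  Δ-step  : ∀ {s t} → s ⟶ t → s =Δ t

Subst : Set
Subst = ℕ → Term

_[_] : Term → Subst → Term
var x   [ σ ] = σ x
(s ⊕ t) [ σ ] = (s [ σ ]) ⊕ (t [ σ ])
(s ⊗ t) [ σ ] = (s [ σ ]) ⊗ (t [ σ ])

-- R-normalized substitution (standing convention).
Normalized : Subst → Set
Normalized σ = ∀ x → NF (σ x)

-- An asymmetric equation  s =↓ t  is represented by the pair (s , t).
AsymEq : Set
AsymEq = Term × Term

AsymUnifies : Subst → AsymEq → Set
AsymUnifies δ (s , t) =
  ((s [ δ ]) =Δ (t [ δ ])) × (∀ n → t ↓≡ n → NF (n [ δ ]))

AsymUnifier : Subst → List AsymEq → Set
AsymUnifier δ Γ = All (AsymUnifies δ) Γ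

module Submission where

-- Look down the right spine of a term through the right arguments of ×:
-- whether it ends in + is invariant under Δ, since the rule only rewrites
-- X×(Y+Z), whose spine ends in +, into X×Y+X×Z, which is a sum. A normal
-- product can have no + on its right spine (that would be a redex), whereas
-- δ(X)+δ(Y) trivially has one; so δ(U) cannot be Δ-equal to both.

open import Defs
open import Data.Nat using (ℕ)
open import Data.Bool using (Bool; true; false)
open import Data.Product using (_×_; _,_)
open import Data.List using (_∷_; [])
open import Data.List.Relation.Unary.All using (_∷_; [])
open import Relation.Nullary using (¬_)
open import Relation.Binary.PropositionalEquality using (_≡_; refl; sym; trans)

endsInSum : Term → Bool
endsInSum (var _) = false
endsInSum (_ ⊕ _) = true
endsInSum (_ ⊗ t) = endsInSum t

⟶-preserves-endsInSum : ∀ {s t} → s ⟶ t → endsInSum s ≡ endsInSum t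
⟶-preserves-endsInSum (root _ _ _) = refl
⟶-preserves-endsInSum (⊕ˡ _ _)     = refl
⟶-preserves-endsInSum (⊕ʳ _ _)     = refl
⟶-preserves-endsInSum (⊗ˡ _ _)     = refl
⟶-preserves-endsInSum (⊗ʳ _ p)     = ⟶-preserves-endsInSum p

=Δ-preserves-endsInSum : ∀ {s t} → s =Δ t → endsInSum s ≡ endsInSum t
=Δ-preserves-endsInSum Δ-refl        = refl
=Δ-preserves-endsInSum (Δ-sym p)     = sym (=Δ-preserves-endsInSum p)
=Δ-preserves-endsInSum (Δ-trans p q) =
  trans (=Δ-preserves-endsInSum p) (=Δ-preserves-endsInSum q)
=Δ-preserves-endsInSum (Δ-step p)    = ⟶-preserves-endsInSum p

NF-⊗⇒¬endsInSum : ∀ a t → NF (a ⊗ t) → endsInSum (a ⊗ t) ≡ false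
NF-⊗⇒¬endsInSum a (var _)   nf = refl
NF-⊗⇒¬endsInSum a (t ⊕ t′)  nf with () ← nf _ (root a t t′)
NF-⊗⇒¬endsInSum a (t ⊗ t′)  nf =
  NF-⊗⇒¬endsInSum t t′ (λ _ step → nf _ (⊗ʳ a step))

NF-var⊗var : ∀ V W → NF (var V ⊗ var W)
NF-var⊗var V W _ (⊗ˡ _ ())
NF-var⊗var V W _ (⊗ʳ _ ())

normal-product≠Δ-sum : ∀ a b c d → NF (a ⊗ b) → ¬ (a ⊗ b) =Δ (c ⊕ d)
normal-product≠Δ-sum a b c d nf eq
  with () ← trans (sym (=Δ-preserves-endsInSum eq)) (NF-⊗⇒¬endsInSum a b nf)

lemma7p6 : (U V W X Y : ℕ) →
    (∀ (δ : Subst) → Normalized δ →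
       ¬ AsymUnifier δ ((var U , var V ⊗ var W) ∷ (var U , var X ⊕ var Y) ∷ []))
    × (∀ (δ : Subst) → Normalized δ →
       ¬ AsymUnifier δ ((var U , var V ⊗ var W) ∷ (var X ⊕ var Y , var U) ∷ []))
lemma7p6 U V W X Y =
  (λ δ _ → λ { ((U=VW , VW↓) ∷ (U=X+Y , _) ∷ []) →
     normal-product≠Δ-sum (δ V) (δ W) (δ X) (δ Y) (VW↓ _ (ε , NF-var⊗var V W))
       (Δ-trans (Δ-sym U=VW) U=X+Y) })
  , (λ δ _ → λ { ((U=VW , VW↓) ∷ (X+Y=U , _) ∷ []) →
     normal-product≠Δ-sum (δ V) (δ W) (δ X) (δ Y) (VW↓ _ (ε , NF-var⊗var V W))
       (Δ-trans (Δ-sym U=VW) (Δ-sym X+Y=U)) })
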